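{- Let $q$ be a prime power and $k\ge 2$. The graph $\Gamma^s(k,q)$ is connected.
   Context: Let $n=[k]_q=\frac{q^k-1}{q-1}$ and $V=\mathbb{F}_q^n$. A $k$-dimensional subspace $C\subseteq V$ is a $q$-ary simplex code of dimension $k$ if the columns of a generator matrix of $C$ are non-zero and mutually non-proportional. $\Gamma^s(k,q)$ is the simple graph whose vertices are the $q$-ary simplex codes of dimension $k$ in $V$, two distinct such codes being adjacent iff their intersection is $(k-1)$-dimensional (i.e. the induced subgraph of the Grassmann graph of $k$-dimensional subspaces of $V$). -}

module Defs where

open import Level using (0ℓ)
open import Data.Nat using (ℕ; zero; suc; _^_) renaming (_+_ to _+ℕ_; _∸_ to _∸ℕ_)
open import Data.Nat.Primality using (Prime)
open import Data.Fin using (Fin; zero; suc)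
open import Data.Product using (Σ; ∃; ∃₂; _×_; _,_)
open import Data.Sum using (_⊎_)
open import Relation.Nullary using (¬_)
open import Relation.Binary.PropositionalEquality using (_≡_)
open import Relation.Binary.Construct.Closure.ReflexiveTransitive using (Star)
open import Algebra.Structures using (IsCommutativeRing)
open import Function.Bundles using (_↔_)

IsPrimePower : ℕ → Set
IsPrimePower q = ∃₂ λ p m → Prime p × q ≡ p ^ suc m

-- [k]_q = 1 + q + ... + q^(k-1) = (q^k - 1)/(q - 1)
[_]_ : ℕ → ℕ → ℕ
[ zero ] q = 0
[ suc k ] q = (q ^ k) +ℕ ([ k ] q)

record FiniteField (q : ℕ) : Set₁ where
  field
    Carrier : Set
    _+_ _*_ : Carrier → Carrier → Carrier
    -_ : Carrier → Carrier
    0# 1# : Carrier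
    isCommutativeRing : IsCommutativeRing _≡_ _+_ _*_ -_ 0# 1#
    0≢1 : ¬ (0# ≡ 1#)
    inverse : ∀ x → ¬ (x ≡ 0#) → ∃ λ y → x * y ≡ 1#
    enumeration : Fin q ↔ Carrier

module Codes {q : ℕ} (F : FiniteField q) where
  open FiniteField F

  Vector : ℕ → Set
  Vector n = Fin n → Carrier

  Family : ℕ → ℕ → Set
  Family m n = Fin m → Vector n

  lincomb : ∀ {m n} → (Fin m → Carrier) → Family m n → Vector n
  lincomb {zero}  c v j = 0#
  lincomb {suc m} c v j = (c zero * v zero j) + lincomb (λ i → c (suc i)) (λ i → v (suc i)) j

  LinIndep : ∀ {m n} → Family m n → Set
  LinIndep {m} {n} v = ∀ (c : Fin m → Carrier) → (∀ j → lincomb c v j ≡ 0#) → ∀ i → c i ≡ 0#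

  InSpan : ∀ {m n} → Family m n → Vector n → Set
  InSpan {m} G v = ∃ λ (c : Fin m → Carrier) → ∀ j → lincomb c G j ≡ v j

  SameSpan : ∀ {m m' n} → Family m n → Family m' n → Set
  SameSpan G H = ∀ v → (InSpan G v → InSpan H v) × (InSpan H v → InSpan G v)

  IsSimplexGenerator : ∀ {k n} → Family k n → Set
  IsSimplexGenerator {k} {n} G =
    LinIndep G ×
    (∀ j → ¬ (∀ i → G i j ≡ 0#)) ×
    (∀ j j' → ¬ (j ≡ j') → ¬ (∃ λ a → ∀ i → G i j' ≡ a * G i j))

  -- vertices of Γ^s(k,q): simplex codes, represented by a generator matrix
  SimplexCode : (k : ℕ) → Set
  SimplexCode k = Σ (Family k ([ k ] q)) IsSimplexGenerator

  SameCode : ∀ {k} → SimplexCode k → SimplexCode k → Set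
  SameCode (G , _) (H , _) = SameSpan G H

  -- adjacency: distinct codes whose intersection has dimension k-1,
  -- i.e. C ∩ C' has a basis of k-1 vectors
  Adjacent : ∀ {k} → SimplexCode k → SimplexCode k → Set
  Adjacent {k} (G , _) (H , _) =
    ¬ SameSpan G H ×
    ∃ λ (B : Family (k ∸ℕ 1) ([ k ] q)) →
      LinIndep B ×
      (∀ i → InSpan G (B i) × InSpan H (B i)) ×
      (∀ v → InSpan G v → InSpan H v → InSpan B v)

  -- a walk in Γ^s(k,q); steps between different generator matrices of the same code are
  -- trivial (they are the same vertex)
  Step : ∀ {k} → SimplexCode k → SimplexCode k → Set
  Step C D = SameCode C D ⊎ Adjacent C D

  Connected : ℕ → Set
  Connected k = ∀ (C D : SimplexCode k) → Star Step C D

{-# OPTIONS --safe #-}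

-- The nonzero multiples of the columns of a simplex generator matrix are pairwise distinct, so by
-- counting they exhaust the nonzero vectors of F^k: the columns of any two generators agree up to a
-- permutation and nonzero scalars. Hence one generator is carried to the other column by column by
-- transposing two columns and rescaling one. Each such move fixes every codeword x G with x in a
-- hyperplane (x · (G_P - G_m) = 0, resp. x · G_P = 0), a (k-1)-dimensional subcode, so it leads to
-- the same code or to an adjacent one.
module Submission where

open import Defs
open import Level using (0ℓ)
open import Data.Nat as ℕ using (ℕ; zero; suc; _≥_)
open import Data.Fin as Fin using (Fin; zero; suc; punchIn; punchOut)
import Data.Fin.Properties as Finₚ
import Data.Nat.Properties as ℕₚ
open import Data.Product using (∃; _×_; _,_; proj₁; proj₂)
open import Data.Sum using (inj₁; inj₂)
open import Data.Empty using (⊥-elim)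
open import Data.Vec.Functional using (updateAt; _∷_)
open import Data.Vec.Functional.Properties using (updateAt-updates; updateAt-minimal)
open import Data.Fin.Permutation as Perm using (Permutation′; _⟨$⟩ʳ_; _⟨$⟩ˡ_)
import Data.Fin.Permutation.Components as PermComponents
open import Function.Base using (_∘_)
open import Function.Bundles using (Inverse)
open import Function.Definitions using (Injective)
open import Function.Construct.Symmetry using (↔-sym)
open import Function.Properties.Inverse using (↔⇒↣)
open import Relation.Nullary using (¬_; Dec; yes; no; contradiction)
open import Relation.Nullary.Decidable using (via-injection; map′)
open import Relation.Binary.Definitions using (DecidableEquality)
open import Relation.Binary.Construct.Closure.ReflexiveTransitive using (Star; ε; _◅_; _◅◅_)
open import Relation.Binary.PropositionalEquality
  using (_≡_; _≢_; _≗_; refl; sym; trans; cong; cong₂; subst; module ≡-Reasoning)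
open import Algebra.Bundles using (CommutativeRing)
import Algebra.Properties.Ring as RingProperties
import Algebra.Properties.CommutativeSemigroup as CommutativeSemigroupProperties

geometric-series : ∀ q k → suc ([ k ] (suc q) ℕ.* q) ≡ suc q ℕ.^ k
geometric-series q zero    = refl
geometric-series q (suc k) = begin
  suc ((Q ℕ.+ [ k ] (suc q)) ℕ.* q)       ≡⟨ cong suc (ℕₚ.*-distribʳ-+ q Q _) ⟩
  suc (Q ℕ.* q ℕ.+ [ k ] (suc q) ℕ.* q)   ≡⟨ ℕₚ.+-suc (Q ℕ.* q) _ ⟨
  Q ℕ.* q ℕ.+ suc ([ k ] (suc q) ℕ.* q)   ≡⟨ cong (Q ℕ.* q ℕ.+_) (geometric-series q k) ⟩
  Q ℕ.* q ℕ.+ Q                           ≡⟨ ℕₚ.+-comm (Q ℕ.* q) Q ⟩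
  Q ℕ.+ Q ℕ.* q                           ≡⟨ ℕₚ.*-suc Q q ⟨
  Q ℕ.* suc q                             ≡⟨ ℕₚ.*-comm Q (suc q) ⟩
  suc q ℕ.* Q                             ∎
  where open ≡-Reasoning
        Q = suc q ℕ.^ k

∷-preserves-injective : ∀ {n} {A : Set} {a : A} {g : Fin n → A} →
                        Injective _≡_ _≡_ g → (∀ i → g i ≢ a) → Injective _≡_ _≡_ (a ∷ g)
∷-preserves-injective g-inj a∉g {zero}  {zero}  _      = refl
∷-preserves-injective g-inj a∉g {zero}  {suc j} a≡g_j  = contradiction (sym a≡g_j) (a∉g j)
∷-preserves-injective g-inj a∉g {suc i} {zero}  g_i≡a  = contradiction g_i≡a (a∉g i)
∷-preserves-injective g-inj a∉g {suc i} {suc j} g_i≡g_j = cong suc (g-inj g_i≡g_j)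

module _ {n : ℕ} where
  open PermComponents using (transpose)

  transpose-respects : ∀ {A : Set} (f : Fin n → A) {i j} → f i ≡ f j → ∀ k → f (transpose i j k) ≡ f k
  transpose-respects f {i} {j} fi≡fj k with k Fin.≟ i
  ... | yes refl = sym fi≡fj
  ... | no _ with k Fin.≟ j
  ...   | yes refl = fi≡fj
  ...   | no _ = refl

  transpose-applyˡ : ∀ (i j : Fin n) → transpose i j i ≡ j
  transpose-applyˡ i j with i Fin.≟ i
  ... | yes _ = refl
  ... | no i≢i = contradiction refl i≢i

  transpose-fixes : ∀ {i j k : Fin n} → k ≢ i → k ≢ j → transpose i j k ≡ k
  transpose-fixes {i} {j} {k} k≢i k≢j with k Fin.≟ i
  ... | yes k≡i = contradiction k≡i k≢i
  ... | no _ with k Fin.≟ j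
  ...   | yes k≡j = contradiction k≡j k≢j
  ...   | no _ = refl

module LinearAlgebra {q : ℕ} (F : FiniteField q) where
  open FiniteField F using (Carrier; isCommutativeRing; 0≢1; inverse; enumeration)
  open Codes F

  commutativeRing : CommutativeRing 0ℓ 0ℓ
  commutativeRing = record { isCommutativeRing = isCommutativeRing }

  open CommutativeRing commutativeRing public
    using (_+_; _*_; -_; 0#; 1#; *-assoc; *-comm; +-identityˡ; +-identityʳ; *-identityˡ; *-identityʳ;
           zeroˡ; zeroʳ; distribˡ; distribʳ; -‿inverseʳ; ring; +-commutativeSemigroup)
  open RingProperties ring using (x∙y⁻¹≈ε⇒x≈y; //-rightDividesˡ; -0#≈0#; -1*x≈-x)
  open CommutativeSemigroupProperties +-commutativeSemigroup using (interchange)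

  inv : (x : Carrier) → x ≢ 0# → Carrier
  inv x x≢0 = proj₁ (inverse x x≢0)

  inv-inverseˡ : ∀ {x} (x≢0 : x ≢ 0#) → inv x x≢0 * x ≡ 1#
  inv-inverseˡ {x} x≢0 = trans (*-comm _ x) (proj₂ (inverse x x≢0))

  inv-cancelˡ : ∀ {x} (x≢0 : x ≢ 0#) y → inv x x≢0 * (x * y) ≡ y
  inv-cancelˡ {x} x≢0 y = begin
    inv x x≢0 * (x * y) ≡⟨ *-assoc _ x y ⟨
    (inv x x≢0 * x) * y ≡⟨ cong (_* y) (inv-inverseˡ x≢0) ⟩
    1# * y              ≡⟨ *-identityˡ y ⟩
    y                   ∎
    where open ≡-Reasoning

  inv-cancelʳ : ∀ {x} (x≢0 : x ≢ 0#) y → (y * inv x x≢0) * x ≡ y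
  inv-cancelʳ {x} x≢0 y = begin
    (y * inv x x≢0) * x ≡⟨ *-assoc y _ x ⟩
    y * (inv x x≢0 * x) ≡⟨ cong (y *_) (inv-inverseˡ x≢0) ⟩
    y * 1#              ≡⟨ *-identityʳ y ⟩
    y                   ∎
    where open ≡-Reasoning

  *-solveˡ : ∀ {x y z} (x≢0 : x ≢ 0#) → x * y ≡ z → y ≡ inv x x≢0 * z
  *-solveˡ x≢0 xy≡z = trans (sym (inv-cancelˡ x≢0 _)) (cong (inv _ x≢0 *_) xy≡z)

  *-cancelˡ-≢0 : ∀ {x y z} → x ≢ 0# → x * y ≡ x * z → y ≡ z
  *-cancelˡ-≢0 {x} {y} {z} x≢0 xy≡xz =
    trans (sym (inv-cancelˡ x≢0 y)) (trans (cong (inv x x≢0 *_) xy≡xz) (inv-cancelˡ x≢0 z))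

  x*y≡0⇒y≡0 : ∀ {x y} → x ≢ 0# → x * y ≡ 0# → y ≡ 0#
  x*y≡0⇒y≡0 {x} x≢0 xy≡0 = *-cancelˡ-≢0 x≢0 (trans xy≡0 (sym (zeroʳ x)))

  1≢0 : 1# ≢ 0#
  1≢0 = 0≢1 ∘ sym

  lincomb-cong : ∀ {m n n'} (c d : Vector m) (v : Family m n) (w : Family m n') {j j'} →
                 (∀ i → c i * v i j ≡ d i * w i j') → lincomb c v j ≡ lincomb d w j'
  lincomb-cong {zero}  c d v w eq = refl
  lincomb-cong {suc m} c d v w eq =
    cong₂ _+_ (eq zero) (lincomb-cong (c ∘ suc) (d ∘ suc) (v ∘ suc) (w ∘ suc) (eq ∘ suc))

  lincomb-zero : ∀ {m n} (c : Vector m) (v : Family m n) j → (∀ i → c i * v i j ≡ 0#) →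
                 lincomb c v j ≡ 0#
  lincomb-zero {zero}  c v j eq = refl
  lincomb-zero {suc m} c v j eq =
    trans (cong₂ _+_ (eq zero) (lincomb-zero (c ∘ suc) (v ∘ suc) j (eq ∘ suc))) (+-identityʳ 0#)

  lincomb-single : ∀ {m n} (c : Vector m) (v : Family m n) j s → (∀ i → i ≢ s → c i * v i j ≡ 0#) →
                   lincomb c v j ≡ c s * v s j
  lincomb-single {suc m} c v j zero eq =
    trans (cong (c zero * v zero j +_) (lincomb-zero (c ∘ suc) (v ∘ suc) j (λ i → eq (suc i) λ ())))
          (+-identityʳ _)
  lincomb-single {suc m} c v j (suc s) eq =
    trans (cong₂ _+_ (eq zero λ ())
                     (lincomb-single (c ∘ suc) (v ∘ suc) j s (λ i i≢s → eq (suc i) (i≢s ∘ Finₚ.suc-injective))))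
          (+-identityˡ _)

  lincomb-+ˡ : ∀ {m n} (c d : Vector m) (v : Family m n) j →
               lincomb (λ i → c i + d i) v j ≡ lincomb c v j + lincomb d v j
  lincomb-+ˡ {zero}  c d v j = sym (+-identityʳ 0#)
  lincomb-+ˡ {suc m} c d v j =
    trans (cong₂ _+_ (distribʳ (v zero j) (c zero) (d zero)) (lincomb-+ˡ (c ∘ suc) (d ∘ suc) (v ∘ suc) j))
          (interchange _ _ _ _)

  lincomb-*ˡ : ∀ {m n} t (c : Vector m) (v : Family m n) j →
               lincomb (λ i → t * c i) v j ≡ t * lincomb c v j
  lincomb-*ˡ {zero}  t c v j = sym (zeroʳ t)
  lincomb-*ˡ {suc m} t c v j =
    trans (cong₂ _+_ (*-assoc t (c zero) (v zero j)) (lincomb-*ˡ t (c ∘ suc) (v ∘ suc) j))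
          (sym (distribˡ t _ _))

  lincomb-assoc : ∀ {l m n} (d : Vector l) (β : Family l m) (v : Family m n) j →
                  lincomb d (λ s → lincomb (β s) v) j ≡ lincomb (lincomb d β) v j
  lincomb-assoc {zero}  d β v j = sym (lincomb-zero _ v j (λ i → zeroˡ _))
  lincomb-assoc {suc l} d β v j = begin
    d zero * lincomb (β zero) v j + lincomb (d ∘ suc) (λ s → lincomb (β (suc s)) v) j
      ≡⟨ cong₂ _+_ (sym (lincomb-*ˡ (d zero) (β zero) v j)) (lincomb-assoc (d ∘ suc) (β ∘ suc) v j) ⟩
    lincomb (λ i → d zero * β zero i) v j + lincomb (lincomb (d ∘ suc) (β ∘ suc)) v j
      ≡⟨ lincomb-+ˡ (λ i → d zero * β zero i) (lincomb (d ∘ suc) (β ∘ suc)) v j ⟨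
    lincomb (lincomb d β) v j ∎
    where open ≡-Reasoning

  lincomb-negˡ : ∀ {m n} (c : Vector m) (v : Family m n) j → lincomb (λ i → - c i) v j ≡ - lincomb c v j
  lincomb-negˡ c v j = begin
    lincomb (λ i → - c i) v j      ≡⟨ lincomb-cong _ _ v v (λ i → cong (_* v i j) (sym (-1*x≈-x (c i)))) ⟩
    lincomb (λ i → - 1# * c i) v j ≡⟨ lincomb-*ˡ (- 1#) c v j ⟩
    - 1# * lincomb c v j           ≡⟨ -1*x≈-x _ ⟩
    - lincomb c v j                ∎
    where open ≡-Reasoning

  lincomb-subˡ : ∀ {m n} (c d : Vector m) (v : Family m n) j →
                 lincomb (λ i → c i + - d i) v j ≡ lincomb c v j + - lincomb d v j
  lincomb-subˡ c d v j = trans (lincomb-+ˡ c (λ i → - d i) v j) (cong (lincomb c v j +_) (lincomb-negˡ d v j))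

  linIndep⇒lincomb-injective : ∀ {m n} {K : Family m n} → LinIndep K →
                               ∀ {x y} → (∀ j → lincomb x K j ≡ lincomb y K j) → x ≗ y
  linIndep⇒lincomb-injective {K = K} indep {x} {y} xK≡yK i =
    x∙y⁻¹≈ε⇒x≈y (x i) (y i) (indep _ difference≡0 i)
    where
      difference≡0 : ∀ j → lincomb (λ i → x i + - y i) K j ≡ 0#
      difference≡0 j = begin
        lincomb (λ i → x i + - y i) K j ≡⟨ lincomb-subˡ x y K j ⟩
        lincomb x K j + - lincomb y K j ≡⟨ cong (λ u → u + - lincomb y K j) (xK≡yK j) ⟩
        lincomb y K j + - lincomb y K j ≡⟨ -‿inverseʳ _ ⟩
        0#                              ∎
        where open ≡-Reasoning

  unit : ∀ {m} → Fin m → Vector m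
  unit s = updateAt (λ _ → 0#) s (λ _ → 1#)

  lincomb-unit : ∀ {m n} s (v : Family m n) j → lincomb (unit s) v j ≡ v s j
  lincomb-unit s v j = begin
    lincomb (unit s) v j ≡⟨ lincomb-single (unit s) v j s
                              (λ i i≢s → trans (cong (_* v i j) (updateAt-minimal i s _ i≢s)) (zeroˡ _)) ⟩
    unit s s * v s j     ≡⟨ cong (_* v s j) (updateAt-updates s _) ⟩
    1# * v s j           ≡⟨ *-identityˡ _ ⟩
    v s j                ∎
    where open ≡-Reasoning

  column : ∀ {m} → Vector m → Family m 1
  column a i _ = a i

  infix 8 _·_
  _·_ : ∀ {m} → Vector m → Vector m → Carrier
  x · a = lincomb x (column a) zero

  ·-comm : ∀ {m} (x a : Vector m) → x · a ≡ a · x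
  ·-comm x a = lincomb-cong x a (column a) (column x) (λ i → *-comm (x i) (a i))

  ·-column : ∀ {m n} (x : Vector m) (K : Family m n) j → x · (λ i → K i j) ≡ lincomb x K j
  ·-column x K j = lincomb-cong x x _ K (λ i → refl)

  ·-single : ∀ {m} (x a : Vector m) r → (∀ i → i ≢ r → x i ≡ 0#) → x · a ≡ x r * a r
  ·-single x a r x≡0 =
    lincomb-single x (column a) zero r (λ i i≢r → trans (cong (_* a i) (x≡0 i i≢r)) (zeroˡ (a i)))

  ·-subʳ : ∀ {m} (x a b : Vector m) → x · (λ i → a i + - b i) ≡ x · a + - (x · b)
  ·-subʳ x a b = begin
    x · (λ i → a i + - b i) ≡⟨ ·-comm x _ ⟩
    (λ i → a i + - b i) · x ≡⟨ lincomb-subˡ a b (column x) zero ⟩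
    a · x + - (b · x)       ≡⟨ cong₂ (λ u w → u + - w) (·-comm a x) (·-comm b x) ⟩
    x · a + - (x · b)       ∎
    where open ≡-Reasoning

  pointwise⇒SameSpan : ∀ {m n} {K K' : Family m n} → (∀ i j → K i j ≡ K' i j) → SameSpan K K'
  pointwise⇒SameSpan {K = K} {K'} K≡K' v =
    (λ (x , xK≡v) → x , λ j → trans (lincomb-cong x x K' K (λ i → cong (x i *_) (sym (K≡K' i j)))) (xK≡v j)) ,
    (λ (x , xK'≡v) → x , λ j → trans (lincomb-cong x x K K' (λ i → cong (x i *_) (K≡K' i j))) (xK'≡v j))

  infix 4 _≟_
  _≟_ : DecidableEquality Carrier
  _≟_ = via-injection (↔⇒↣ (↔-sym enumeration)) Fin._≟_

  encode : ∀ {m} → Vector m → Fin (q ℕ.^ m)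
  encode x = Fin.funToFin (Inverse.from enumeration ∘ x)

  decode : ∀ {m} → Fin (q ℕ.^ m) → Vector m
  decode i = Inverse.to enumeration ∘ Fin.finToFun i

  decode-encode : ∀ {m} (x : Vector m) → decode (encode x) ≗ x
  decode-encode x i =
    trans (cong (Inverse.to enumeration) (Finₚ.finToFun-funToFin _ i)) (Inverse.strictlyInverseˡ enumeration (x i))

  encode-injective : ∀ {m} {x y : Vector m} → encode x ≡ encode y → x ≗ y
  encode-injective {x = x} {y} eq i =
    trans (sym (decode-encode x i)) (trans (cong (λ e → decode e i) eq) (decode-encode y i))

  any-scalar? : ∀ {P : Carrier → Set} → (∀ x → Dec (P x)) → Dec (∃ P)
  any-scalar? {P} P? = map′ (λ (i , p) → Inverse.to enumeration i , p)
    (λ (x , p) → Inverse.from enumeration x , subst P (sym (Inverse.strictlyInverseˡ enumeration x)) p)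
    (Finₚ.any? (P? ∘ Inverse.to enumeration))

  any-vector? : ∀ {m} {P : Vector m → Set} → (∀ {x y} → x ≗ y → P x → P y) →
                (∀ x → Dec (P x)) → Dec (∃ P)
  any-vector? resp P? = map′ (λ (i , p) → decode i , p)
                             (λ (x , p) → encode x , resp (λ i → sym (decode-encode x i)) p)
                             (Finₚ.any? (P? ∘ decode))

  inSpan? : ∀ {m n} (G : Family m n) v → Dec (InSpan G v)
  inSpan? G v = any-vector? (λ x≗y xG≡v j → trans (lincomb-cong _ _ G G (λ i → cong (_* G i j) (sym (x≗y i))))
                                                  (xG≡v j))
                            (λ x → Finₚ.all? (λ j → lincomb x G j ≟ v j))

  AgreeOnHyperplane : ∀ {m n} → Vector m → Family m n → Family m n → Set
  AgreeOnHyperplane a K K' = ∀ x → x · a ≡ 0# → ∀ j → lincomb x K j ≡ lincomb x K' j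

  AgreeOnHyperplane-sym : ∀ {m n} {a : Vector m} {K K' : Family m n} →
                          AgreeOnHyperplane a K K' → AgreeOnHyperplane a K' K
  AgreeOnHyperplane-sym agree x x·a≡0 j = sym (agree x x·a≡0 j)

  -- With t = (z · a) / (x · a), z - t x lies in the hyperplane, so z K = (z - t x) K' + t (y K').
  agreeOnHyperplane⇒⊆ : ∀ {m n} {a : Vector m} {K K' : Family m n} → AgreeOnHyperplane a K K' →
                        ∀ x y → x · a ≢ 0# → (∀ j → lincomb x K j ≡ lincomb y K' j) →
                        ∀ v → InSpan K v → InSpan K' v
  agreeOnHyperplane⇒⊆ {a = a} {K} {K'} agree x y x·a≢0 xK≡yK' v (z , zK≡v) =
    (λ i → z' i + t * y i) , λ j → begin
      lincomb (λ i → z' i + t * y i) K' j          ≡⟨ lincomb-+ˡ z' (λ i → t * y i) K' j ⟩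
      lincomb z' K' j + lincomb (λ i → t * y i) K' j ≡⟨ cong (lincomb z' K' j +_) (lincomb-*ˡ t y K' j) ⟩
      lincomb z' K' j + t * lincomb y K' j         ≡⟨ cong₂ _+_ (agree z' z'·a≡0 j) (cong (t *_) (xK≡yK' j)) ⟨
      lincomb z' K j + t * lincomb x K j           ≡⟨ cong (lincomb z' K j +_) (lincomb-*ˡ t x K j) ⟨
      lincomb z' K j + lincomb (λ i → t * x i) K j ≡⟨ lincomb-+ˡ z' (λ i → t * x i) K j ⟨
      lincomb (λ i → z' i + t * x i) K j           ≡⟨ lincomb-cong _ z K K
                                                        (λ i → cong (_* K i j) (//-rightDividesˡ (t * x i) (z i))) ⟩
      lincomb z K j                                ≡⟨ zK≡v j ⟩
      v j                                          ∎
    where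
      open ≡-Reasoning
      t : Carrier
      t = (z · a) * inv (x · a) x·a≢0
      z' : Vector _
      z' i = z i + - (t * x i)
      z'·a≡0 : z' · a ≡ 0#
      z'·a≡0 = begin
        z' · a                              ≡⟨ lincomb-subˡ z (λ i → t * x i) (column a) zero ⟩
        z · a + - ((λ i → t * x i) · a)     ≡⟨ cong (λ u → z · a + - u) (lincomb-*ˡ t x (column a) zero) ⟩
        z · a + - (t * (x · a)) ≡⟨ cong (λ u → z · a + - u) (inv-cancelʳ x·a≢0 (z · a)) ⟩
        z · a + - (z · a)       ≡⟨ -‿inverseʳ (z · a) ⟩
        0#                      ∎

  agreeOnHyperplane⇒sameSpan : ∀ {m n} {a : Vector m} {K K' : Family m n} → LinIndep K →
                               AgreeOnHyperplane a K K' →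
                               ∀ x y → x · a ≢ 0# → (∀ j → lincomb x K j ≡ lincomb y K' j) → SameSpan K K'
  agreeOnHyperplane⇒sameSpan {a = a} {K} {K'} indep agree x y x·a≢0 xK≡yK' v =
    agreeOnHyperplane⇒⊆ agree x y x·a≢0 xK≡yK' v ,
    agreeOnHyperplane⇒⊆ (AgreeOnHyperplane-sym agree) y x y·a≢0 (λ j → sym (xK≡yK' j)) v
    where
      y·a≢0 : y · a ≢ 0#
      y·a≢0 y·a≡0 = x·a≢0 (trans (lincomb-cong x y _ _ (λ i → cong (_* a i) (x≗y i))) y·a≡0)
        where x≗y = linIndep⇒lincomb-injective indep (λ j → trans (xK≡yK' j) (sym (agree y y·a≡0 j)))

  hyperplane-determined : ∀ {k} (a : Vector (suc k)) {r} → a r ≢ 0# → ∀ (x y : Vector (suc k)) →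
                          x · a ≡ 0# → y · a ≡ 0# → (∀ s → x (punchIn r s) ≡ y (punchIn r s)) → x ≗ y
  hyperplane-determined a {r} a_r≢0 x y x·a≡0 y·a≡0 x≡y = x∙y⁻¹≈ε⇒x≈y _ _ ∘ x-y≡0
    where
      x-y : Vector _
      x-y i = x i + - y i
      x-y≡0-off-r : ∀ i → i ≢ r → x-y i ≡ 0#
      x-y≡0-off-r i i≢r = begin
        x i + - y i ≡⟨ cong (λ i' → x i' + - y i') (Finₚ.punchIn-punchOut (i≢r ∘ sym)) ⟨
        x (punchIn r s) + - y (punchIn r s) ≡⟨ cong (_+ - y (punchIn r s)) (x≡y s) ⟩
        y (punchIn r s) + - y (punchIn r s) ≡⟨ -‿inverseʳ _ ⟩
        0#          ∎
        where open ≡-Reasoning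
              s = punchOut (i≢r ∘ sym)
      x-y·a≡0 : x-y · a ≡ 0#
      x-y·a≡0 = begin
        x-y · a           ≡⟨ lincomb-subˡ x y (column a) zero ⟩
        x · a + - (y · a) ≡⟨ cong₂ (λ u w → u + - w) x·a≡0 y·a≡0 ⟩
        0# + - 0#         ≡⟨ -‿inverseʳ 0# ⟩
        0#      ∎
        where open ≡-Reasoning
      x-y≡0 : ∀ i → x-y i ≡ 0#
      x-y≡0 i with i Fin.≟ r
      ... | yes refl =
        x*y≡0⇒y≡0 a_r≢0 (trans (*-comm (a r) _) (trans (sym (·-single x-y a r x-y≡0-off-r)) x-y·a≡0))
      ... | no i≢r = x-y≡0-off-r i i≢r

  module HyperplaneBasis {k} (a : Vector (suc k)) {r} (a_r≢0 : a r ≢ 0#) where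

    β : Family k (suc k)
    β s i = unit (punchIn r s) i + - ((a (punchIn r s) * inv (a r) a_r≢0) * unit r i)

    β-orthogonal : ∀ s → β s · a ≡ 0#
    β-orthogonal s = begin
      β s · a
        ≡⟨ lincomb-subˡ (unit p) (λ i → c * unit r i) (column a) zero ⟩
      unit p · a + - ((λ i → c * unit r i) · a)
        ≡⟨ cong (λ u → unit p · a + - u) (lincomb-*ˡ c (unit r) (column a) zero) ⟩
      unit p · a + - (c * (unit r · a))
        ≡⟨ cong₂ (λ u w → u + - (c * w)) (lincomb-unit p (column a) zero) (lincomb-unit r (column a) zero) ⟩
      a p + - (c * a r)
        ≡⟨ cong (λ u → a p + - u) (inv-cancelʳ a_r≢0 (a p)) ⟩
      a p + - a p
        ≡⟨ -‿inverseʳ (a p) ⟩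
      0# ∎
      where open ≡-Reasoning
            p = punchIn r s
            c = a p * inv (a r) a_r≢0

    β-punchIn : ∀ s' s → β s' (punchIn r s) ≡ unit (punchIn r s') (punchIn r s)
    β-punchIn s' s = begin
      β s' (punchIn r s) ≡⟨ cong (λ u → e + - (_ * u)) (updateAt-minimal _ r _ (Finₚ.punchInᵢ≢i r s)) ⟩
      e + - (_ * 0#)     ≡⟨ cong (λ u → e + - u) (zeroʳ _) ⟩
      e + - 0#           ≡⟨ cong (e +_) -0#≈0# ⟩
      e + 0#             ≡⟨ +-identityʳ e ⟩
      e                  ∎
      where open ≡-Reasoning
            e = unit (punchIn r s') (punchIn r s)

    lincomb-β-punchIn : ∀ (d : Vector k) s → lincomb d β (punchIn r s) ≡ d s
    lincomb-β-punchIn d s = begin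
      lincomb d β (punchIn r s) ≡⟨ lincomb-single d β _ s β-vanishes ⟩
      d s * β s (punchIn r s)   ≡⟨ cong (d s *_) (trans (β-punchIn s s) (updateAt-updates (punchIn r s) _)) ⟩
      d s * 1#                  ≡⟨ *-identityʳ (d s) ⟩
      d s                       ∎
      where
        open ≡-Reasoning
        β-vanishes : ∀ s' → s' ≢ s → d s' * β s' (punchIn r s) ≡ 0#
        β-vanishes s' s'≢s = trans (cong (d s' *_) (trans (β-punchIn s' s)
          (updateAt-minimal _ _ _ (s'≢s ∘ sym ∘ Finₚ.punchIn-injective r s s')))) (zeroʳ (d s'))

    β-spans : ∀ x → x · a ≡ 0# → lincomb (x ∘ punchIn r) β ≗ x
    β-spans x x·a≡0 = hyperplane-determined a a_r≢0 _ x w·a≡0 x·a≡0 (lincomb-β-punchIn (x ∘ punchIn r))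
      where
        w·a≡0 : lincomb (x ∘ punchIn r) β · a ≡ 0#
        w·a≡0 = trans (sym (lincomb-assoc (x ∘ punchIn r) β (column a) zero))
                      (lincomb-zero _ (λ s → lincomb (β s) (column a)) zero
                                    (λ s → trans (cong (x (punchIn r s) *_) (β-orthogonal s)) (zeroʳ _)))

module SimplexMoves {q : ℕ} (F : FiniteField q) where
  open FiniteField F using (Carrier)
  open Codes F
  open LinearAlgebra F
  open RingProperties ring using (x∙y⁻¹≈ε⇒x≈y)

  agreeOnHyperplane⇒Step : ∀ {k} {C D : SimplexCode (suc k)} {a : Vector (suc k)} →
                           ¬ (∀ i → a i ≡ 0#) → AgreeOnHyperplane a (proj₁ C) (proj₁ D) → Step C D
  -- Both codes contain the (k-1)-dimensional image B of the hyperplane; they coincide exactly when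
  -- the row K r, which lies outside it, belongs to the span of K'.
  agreeOnHyperplane⇒Step {C = K , indep , _} {D = K' , _} {a} a≢0 agree
    with r , a_r≢0 ← Finₚ.¬∀⟶∃¬ _ _ (λ i → a i ≟ 0#) a≢0
    with inSpan? K' (K r)
  ... | yes (y , yK'≡K_r) =
    inj₁ (agreeOnHyperplane⇒sameSpan {a = a} {K} {K'} indep agree (unit r) y
            (a_r≢0 ∘ trans (sym (lincomb-unit r (column a) zero)))
            (λ j → trans (lincomb-unit r K j) (sym (yK'≡K_r j))))
  ... | no K_r∉K' = inj₂ (K≢K' , B , B-linIndep , B-common , meet⊆B)
    where
      open HyperplaneBasis a a_r≢0

      K≢K' : ¬ SameSpan K K'
      K≢K' same = K_r∉K' (proj₁ (same (K r)) (unit r , lincomb-unit r K))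

      B : Family _ _
      B s = lincomb (β s) K

      B-linIndep : LinIndep B
      B-linIndep d dB≡0 s = trans (sym (lincomb-β-punchIn d s))
        (indep (lincomb d β) (λ j → trans (sym (lincomb-assoc d β K j)) (dB≡0 j)) (punchIn r s))

      B-common : ∀ s → InSpan K (B s) × InSpan K' (B s)
      B-common s = (β s , λ j → refl) , (β s , λ j → sym (agree (β s) (β-orthogonal s) j))

      meet⊆B : ∀ v → InSpan K v → InSpan K' v → InSpan B v
      meet⊆B v (x , xK≡v) (y , yK'≡v) with x · a ≟ 0#
      ... | no x·a≢0 = contradiction
        (agreeOnHyperplane⇒sameSpan {a = a} {K} {K'} indep agree x y x·a≢0 (λ j → trans (xK≡v j) (sym (yK'≡v j))))
        K≢K'
      ... | yes x·a≡0 = x ∘ punchIn r , λ j →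
        trans (lincomb-assoc (x ∘ punchIn r) β K j)
              (trans (lincomb-cong _ x K K (λ i → cong (_* K i j) (β-spans x x·a≡0 i))) (xK≡v j))

  monomial : ∀ {k n} → Permutation′ n → Vector n → Family k n → Family k n
  monomial π σ K i j = σ j * K i (π ⟨$⟩ʳ j)

  lincomb-monomial : ∀ {k n} (π : Permutation′ n) σ (K : Family k n) c j →
                     lincomb c (monomial π σ K) j ≡ σ j * lincomb c K (π ⟨$⟩ʳ j)
  lincomb-monomial π σ K c j =
    trans (lincomb-cong c (λ i → σ j * c i) _ K (λ i → x[yz]≡[yx]z (c i) (σ j) _)) (lincomb-*ˡ (σ j) c K _)
    where
      x[yz]≡[yx]z : ∀ x y z → x * (y * z) ≡ (y * x) * z
      x[yz]≡[yx]z x y z = trans (sym (*-assoc x y z)) (cong (_* z) (*-comm x y))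

  monomial-isSimplexGenerator : ∀ {k n} (π : Permutation′ n) {σ : Vector n} → (∀ j → σ j ≢ 0#) →
                                {K : Family k n} → IsSimplexGenerator K → IsSimplexGenerator (monomial π σ K)
  monomial-isSimplexGenerator π {σ} σ≢0 {K} (indep , nonzero , nonproportional) =
    independent , (λ j M_j≡0 → nonzero (π ⟨$⟩ʳ j) (x*y≡0⇒y≡0 (σ≢0 j) ∘ M_j≡0)) , proportional
    where
      independent : LinIndep (monomial π σ K)
      independent c cM≡0 = indep c λ j → subst (λ j' → lincomb c K j' ≡ 0#) (Perm.inverseʳ π)
        (x*y≡0⇒y≡0 (σ≢0 (π ⟨$⟩ˡ j)) (trans (sym (lincomb-monomial π σ K c _)) (cM≡0 _)))

      proportional : ∀ j j' → j ≢ j' → ¬ ∃ λ t → ∀ i → monomial π σ K i j' ≡ t * monomial π σ K i j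
      proportional j j' j≢j' (t , M_j'≡tM_j) = nonproportional (π ⟨$⟩ʳ j) (π ⟨$⟩ʳ j')
        (j≢j' ∘ λ πj≡πj' → trans (sym (Perm.inverseˡ π))
                                  (trans (cong (π ⟨$⟩ˡ_) πj≡πj') (Perm.inverseˡ π)))
        ((inv (σ j') (σ≢0 j') * t) * σ j , λ i → begin
          K i (π ⟨$⟩ʳ j')                              ≡⟨ *-solveˡ (σ≢0 j') (M_j'≡tM_j i) ⟩
          inv (σ j') (σ≢0 j') * (t * (σ j * K i (π ⟨$⟩ʳ j))) ≡⟨ *-assoc _ t _ ⟨
          (inv (σ j') (σ≢0 j') * t) * (σ j * K i (π ⟨$⟩ʳ j)) ≡⟨ *-assoc _ (σ j) _ ⟨
          ((inv (σ j') (σ≢0 j') * t) * σ j) * K i (π ⟨$⟩ʳ j) ∎)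
        where open ≡-Reasoning

  monomialCode : ∀ {k} (π : Permutation′ ([ k ] q)) (σ : Vector ([ k ] q)) → (∀ j → σ j ≢ 0#) →
                 SimplexCode k → SimplexCode k
  monomialCode π σ σ≢0 (K , isSimplex) = monomial π σ K , monomial-isSimplexGenerator π σ≢0 isSimplex

  transposeColumns : ∀ {k} → Fin ([ k ] q) → Fin ([ k ] q) → SimplexCode k → SimplexCode k
  transposeColumns P m = monomialCode (Perm.transpose P m) (λ _ → 1#) (λ _ → 1≢0)

  scaling : ∀ {n} → Fin n → Carrier → Vector n
  scaling P l = updateAt (λ _ → 1#) P (λ _ → l)

  scaling-≢0 : ∀ {n} (P : Fin n) {l} → l ≢ 0# → ∀ j → scaling P l j ≢ 0#
  scaling-≢0 P l≢0 j with j Fin.≟ P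
  ... | yes refl = l≢0 ∘ trans (sym (updateAt-updates P _))
  ... | no j≢P = 1≢0 ∘ trans (sym (updateAt-minimal j P _ j≢P))

  scaleColumn : ∀ {k} → Fin ([ k ] q) → (l : Carrier) → l ≢ 0# → SimplexCode k → SimplexCode k
  scaleColumn P l l≢0 = monomialCode Perm.id (scaling P l) (scaling-≢0 P l≢0)

  transposeColumns-step : ∀ {k} (C : SimplexCode (suc k)) P m → Step C (transposeColumns P m C)
  transposeColumns-step C@(K , _ , _ , nonproportional) P m with P Fin.≟ m
  ... | yes refl = inj₁ (pointwise⇒SameSpan {K = K} {proj₁ (transposeColumns P P C)} λ i j →
                     sym (trans (*-identityˡ _) (transpose-respects (K i) {P} {P} refl j)))
  ... | no P≢m = agreeOnHyperplane⇒Step {C = C} {D = transposeColumns P m C} a≢0 agree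
    where
      a : Vector _
      a i = K i P + - K i m

      a≢0 : ¬ (∀ i → a i ≡ 0#)
      a≢0 a≡0 = nonproportional P m P≢m
        (1# , λ i → trans (sym (x∙y⁻¹≈ε⇒x≈y _ _ (a≡0 i))) (sym (*-identityˡ _)))

      agree : AgreeOnHyperplane a K (proj₁ (transposeColumns P m C))
      agree x x·a≡0 j = begin
        lincomb x K j                                    ≡⟨ transpose-respects (lincomb x K) xK_P≡xK_m j ⟨
        lincomb x K (Perm.transpose P m ⟨$⟩ʳ j)          ≡⟨ *-identityˡ _ ⟨
        1# * lincomb x K (Perm.transpose P m ⟨$⟩ʳ j)     ≡⟨ lincomb-monomial (Perm.transpose P m) (λ _ → 1#) K x j ⟨
        lincomb x (proj₁ (transposeColumns P m C)) j     ∎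
        where
          open ≡-Reasoning
          xK_P≡xK_m : lincomb x K P ≡ lincomb x K m
          xK_P≡xK_m = x∙y⁻¹≈ε⇒x≈y _ _ (begin
            lincomb x K P + - lincomb x K m           ≡⟨ cong₂ (λ u w → u + - w) (·-column x K P) (·-column x K m) ⟨
            x · (λ i → K i P) + - (x · (λ i → K i m)) ≡⟨ ·-subʳ x (λ i → K i P) (λ i → K i m) ⟨
            x · a                                     ≡⟨ x·a≡0 ⟩
            0#                                        ∎)

  scaleColumn-step : ∀ {k} (C : SimplexCode (suc k)) P {l} (l≢0 : l ≢ 0#) → Step C (scaleColumn P l l≢0 C)
  scaleColumn-step C@(K , _ , nonzero , _) P {l} l≢0 =
    agreeOnHyperplane⇒Step {C = C} {D = scaleColumn P l l≢0 C} (nonzero P) agree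
    where
      agree : AgreeOnHyperplane (λ i → K i P) K (proj₁ (scaleColumn P l l≢0 C))
      agree x x·K_P≡0 j = sym (trans (lincomb-monomial Perm.id (scaling P l) K x j) (unchanged j))
        where
          unchanged : ∀ j → scaling P l j * lincomb x K j ≡ lincomb x K j
          unchanged j with j Fin.≟ P
          ... | yes refl = trans (cong (_ *_) xK_P≡0) (trans (zeroʳ _) (sym xK_P≡0))
            where xK_P≡0 = trans (sym (·-column x K P)) x·K_P≡0
          ... | no j≢P = trans (cong (_* lincomb x K j) (updateAt-minimal j P _ j≢P)) (*-identityˡ _)

module Connectivity {q : ℕ} (F : FiniteField (suc q)) where
  open FiniteField F using (Carrier; enumeration)
  open Codes F
  open LinearAlgebra F
  open SimplexMoves F

  nonzeroScalar : Fin q → Carrier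
  nonzeroScalar t = Inverse.to enumeration (punchIn (Inverse.from enumeration 0#) t)

  nonzeroScalar-≢0 : ∀ t → nonzeroScalar t ≢ 0#
  nonzeroScalar-≢0 t t≡0 = Finₚ.punchInᵢ≢i _ t
    (trans (sym (Inverse.strictlyInverseʳ enumeration _)) (cong (Inverse.from enumeration) t≡0))

  nonzeroScalar-injective : Injective _≡_ _≡_ nonzeroScalar
  nonzeroScalar-injective {s} {t} eq = Finₚ.punchIn-injective _ s t
    (trans (sym (Inverse.strictlyInverseʳ enumeration _))
           (trans (cong (Inverse.from enumeration) eq) (Inverse.strictlyInverseʳ enumeration _)))

  -- The q [k]_{q+1} nonzero multiples of the columns are pairwise distinct; together with 0 and
  -- a vector off all columns they would exceed the (q+1)^k = 1 + q [k]_{q+1} vectors of F^k.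
  simplex-columns-cover : ∀ {k} (C : SimplexCode k) (x : Vector k) → ¬ (∀ i → x i ≡ 0#) →
                          ∃ λ m → ∃ λ l → ∀ i → x i ≡ l * proj₁ C i m
  simplex-columns-cover {k} (K , _ , nonzero , nonproportional) x x≢0
    with Finₚ.any? (λ m → any-scalar? (λ l → Finₚ.all? (λ i → x i ≟ l * K i m)))
  ... | yes cover = cover
  ... | no ¬cover = ⊥-elim (ℕₚ.1+n≰n (subst (suc (suc (n ℕ.* q)) ℕ.≤_) (sym (geometric-series q k))
                                    (Finₚ.injective⇒≤ points-injective)))
    where
      n = [ k ] (suc q)

      multiple : Fin n → Fin q → Vector k
      multiple j t i = nonzeroScalar t * K i j

      multiple-≢0 : ∀ j t → ¬ (∀ i → multiple j t i ≡ 0#)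
      multiple-≢0 j t m≡0 = nonzero j (x*y≡0⇒y≡0 (nonzeroScalar-≢0 t) ∘ m≡0)

      multiple-injective : ∀ {j j' t t'} → multiple j t ≗ multiple j' t' → (j , t) ≡ (j' , t')
      multiple-injective {j} {j'} {t} {t'} eq with j Fin.≟ j'
      ... | no j≢j' = contradiction
        (_ , λ i → trans (*-solveˡ (nonzeroScalar-≢0 t') (sym (eq i))) (sym (*-assoc _ _ _)))
        (nonproportional j j' j≢j')
      ... | yes refl = cong (j ,_) (nonzeroScalar-injective
                                     (*-cancelˡ-≢0 K_i₀j≢0 (trans (*-comm _ _) (trans (eq i₀) (*-comm _ _)))))
        where i₀,K_i₀j≢0 = Finₚ.¬∀⟶∃¬ _ _ (λ i → K i j ≟ 0#) (nonzero j)
              i₀ = proj₁ i₀,K_i₀j≢0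
              K_i₀j≢0 = proj₂ i₀,K_i₀j≢0

      0ᵛ : Vector k
      0ᵛ _ = 0#

      points : Fin (suc (suc (n ℕ.* q))) → Fin (suc q ℕ.^ k)
      points = encode x ∷ (encode 0ᵛ ∷ λ u → let j , t = Fin.remQuot q u in encode (multiple j t))

      points-injective : Injective _≡_ _≡_ points
      points-injective = ∷-preserves-injective (∷-preserves-injective multiples-injective multiple≢0) x∉rest
        where
          multiples-injective : ∀ {u u'} → points (suc (suc u)) ≡ points (suc (suc u')) → u ≡ u'
          multiples-injective {u} {u'} eq = trans (sym (Finₚ.combine-remQuot {n} q u))
            (trans (cong (λ (j , t) → Fin.combine j t) (multiple-injective (encode-injective eq)))
                   (Finₚ.combine-remQuot {n} q u'))
          multiple≢0 : ∀ u → points (suc (suc u)) ≢ encode 0ᵛ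
          multiple≢0 u eq = multiple-≢0 _ _ (encode-injective eq)
          x∉rest : ∀ u → points (suc u) ≢ encode x
          x∉rest zero eq = x≢0 (λ i → sym (encode-injective eq i))
          x∉rest (suc u) eq = ¬cover (_ , _ , λ i → sym (encode-injective eq i))

  AgreeBelow : ∀ {k} → ℕ → SimplexCode k → SimplexCode k → Set
  AgreeBelow p C D = ∀ j → Fin.toℕ j ℕ.< p → ∀ i → proj₁ C i j ≡ proj₁ D i j

  -- Column p of D is l times some column m of C with m ≥ p; moving m to position p and scaling
  -- by l leaves the columns below p alone.
  extend-agreement : ∀ {k p} {C D : SimplexCode (suc k)} (p<n : p ℕ.< [ suc k ] (suc q)) → AgreeBelow p C D →
                     ∃ λ C' → Star Step C C' × AgreeBelow (suc p) C' D
  extend-agreement {k} {p} {C@(K , _)} {D@(H , _ , H-nonzero , H-nonproportional)} p<n C≡D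
    with m , l , H_P≡lK_m ← simplex-columns-cover C (λ i → H i (Fin.fromℕ< p<n)) (H-nonzero _) =
    C₂ , _◅_ {j = C₁} (transposeColumns-step C P m) (scaleColumn-step C₁ P l≢0 ◅ ε) , C₂≡D
    where
      P = Fin.fromℕ< p<n

      P≢below : ∀ {j} → Fin.toℕ j ℕ.< p → j ≢ P
      P≢below j<p refl = ℕₚ.<⇒≢ j<p (Finₚ.toℕ-fromℕ< p<n)

      l≢0 : l ≢ 0#
      l≢0 refl = H-nonzero P λ i → trans (H_P≡lK_m i) (zeroˡ _)

      m≮p : ¬ Fin.toℕ m ℕ.< p
      m≮p m<p = H-nonproportional m P (P≢below m<p) (l , λ i → trans (H_P≡lK_m i) (cong (l *_) (C≡D m m<p i)))

      C₁ C₂ : SimplexCode (suc k)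
      C₁ = transposeColumns P m C
      C₂ = scaleColumn P l l≢0 C₁

      C₂≡D-at-P : ∀ i → proj₁ C₂ i P ≡ H i P
      C₂≡D-at-P i = begin
        scaling P l P * (1# * K i (PermComponents.transpose P m P))
          ≡⟨ cong₂ (λ s j' → s * (1# * K i j')) (updateAt-updates P _) (transpose-applyˡ P m) ⟩
        l * (1# * K i m) ≡⟨ cong (l *_) (*-identityˡ _) ⟩
        l * K i m        ≡⟨ H_P≡lK_m i ⟨
        H i P            ∎
        where open ≡-Reasoning

      C₂≡D : AgreeBelow (suc p) C₂ D
      C₂≡D j j<1+p i with ℕₚ.m<1+n⇒m<n∨m≡n j<1+p
      ... | inj₁ j<p = begin
        scaling P l j * (1# * K i (PermComponents.transpose P m j))
          ≡⟨ cong₂ (λ s j' → s * (1# * K i j')) (updateAt-minimal j P _ (P≢below j<p))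
                                                (transpose-fixes (P≢below j<p) (λ { refl → m≮p j<p })) ⟩
        1# * (1# * K i j) ≡⟨ trans (*-identityˡ _) (*-identityˡ _) ⟩
        K i j             ≡⟨ C≡D j j<p i ⟩
        H i j             ∎
        where open ≡-Reasoning
      ... | inj₂ j≡p = subst (λ j → proj₁ C₂ i j ≡ H i j)
                             (sym (Finₚ.toℕ-injective (trans j≡p (sym (Finₚ.toℕ-fromℕ< p<n))))) (C₂≡D-at-P i)

  walk-to-agreement : ∀ {k} (C D : SimplexCode (suc k)) p → p ℕ.≤ [ suc k ] (suc q) →
                      ∃ λ C' → Star Step C C' × AgreeBelow p C' D
  walk-to-agreement C D zero    _   = C , ε , λ j ()
  walk-to-agreement C D (suc p) p<n =
    let C' , C→C' , C'≡D = walk-to-agreement C D p (ℕₚ.<⇒≤ p<n)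
        C'' , C'→C'' , C''≡D = extend-agreement {C = C'} {D} p<n C'≡D
    in C'' , C→C' ◅◅ C'→C'' , C''≡D

  connected : ∀ k → Connected (suc k)
  connected k C D =
    let C' , C→C' , C'≡D = walk-to-agreement C D _ ℕₚ.≤-refl
    in C→C' ◅◅ inj₁ (pointwise⇒SameSpan {K = proj₁ C'} {proj₁ D} λ i j → C'≡D j (Finₚ.toℕ<n j) i)
            ◅ ε

proposition2 : (q : ℕ) → IsPrimePower q → (F : FiniteField q) → (k : ℕ) → k ≥ 2 →
    Codes.Connected F k
proposition2 zero    _ F _       _  = ⊥-elim (Finₚ.¬Fin0 (Inverse.from enumeration 0#))
  where open FiniteField F
proposition2 (suc q) _ F (suc k) _  = Connectivity.connected F k
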